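{- Every nice board $B$ has a unique $(0,1)$-filling with exactly one 1 in each row and each column that avoids both boards $B_{1324}$ and $B_{3416725}$.
   Context: A nice board is a skew-Ferrers board (a set of cells of a grid such that whenever it contains cells $(a,b)$ and $(c,d)$ with $a\le c$, $b\le d$ it contains all cells $(k,l)$ with $a\le k\le c$, $b\le l\le d$) with equally many rows and columns that contains all cells of the antidiagonal. A $(0,1)$-filled nice board $B$ contains a $(0,1)$-filled nice board $B'$ if $B'$ can be obtained from $B$ by deleting an equal number of rows and columns (i.e. there are $k$ rows and $k$ columns of $B$ such that the cells of $B$ at their intersections, with their entries and after renumbering, form exactly $B'$, both in shape and in filling); otherwise $B$ avoids $B'$. Here $B_{1324}$ is the full $2\times 2$ board with 1's in (column 1, row 2) and (column 2, row 1) (columns counted left to right, rows bottom to top), and $B_{3416725}$ is the $3\times 3$ skew board whose bottom row consists of the cells in columns 2,3, middle row of columns 1,2,3, top row of columns 1,2, with 1's in (column 1, row 2), (column 2, row 3), (column 3, row 1) and 0's elsewhere. -}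

module Defs where

open import Data.Nat using (ℕ; suc)
open import Data.Fin using (Fin; zero; suc; _≤_; _<_; opposite)
open import Data.Bool using (Bool; true; false)
open import Data.Product using (Σ; _×_; _,_)
open import Relation.Binary.PropositionalEquality using (_≡_)
open import Relation.Nullary using (¬_)

-- Conventions: a cell is given by (column, row); columns are numbered
-- 0..n-1 from left to right, rows 0..n-1 from bottom to top.

Shape : ℕ → Set
Shape n = Fin n → Fin n → Bool

IsSkewFerrers : {n : ℕ} → Shape n → Set
IsSkewFerrers {n} S =
  (a b c d : Fin n) → S a b ≡ true → S c d ≡ true → a ≤ c → b ≤ d →
  (k l : Fin n) → a ≤ k → k ≤ c → b ≤ l → l ≤ d → S k l ≡ true

ContainsAntidiagonal : {n : ℕ} → Shape n → Set
ContainsAntidiagonal {n} S = (i : Fin n) → S i (opposite i) ≡ true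

IsNice : {n : ℕ} → Shape n → Set
IsNice S = IsSkewFerrers S × ContainsAntidiagonal S

-- a (0,1)-filled board: size, shape and filling (true = 1); entries of the
-- filling outside the shape are irrelevant.
record FilledBoard : Set where
  constructor board
  field
    size  : ℕ
    shape : Shape size
    fill  : Fin size → Fin size → Bool
open FilledBoard public

StrictlyIncreasing : {k n : ℕ} → (Fin k → Fin n) → Set
StrictlyIncreasing {k} f = (i j : Fin k) → i < j → f i < f j

Contains : FilledBoard → FilledBoard → Set
Contains B P =
  Σ (Fin (size P) → Fin (size B)) λ φ →
  Σ (Fin (size P) → Fin (size B)) λ ψ →
    StrictlyIncreasing φ × StrictlyIncreasing ψ ×
    ((i j : Fin (size P)) →
       (shape B (φ i) (ψ j) ≡ shape P i j) ×
       (shape P i j ≡ true → fill B (φ i) (ψ j) ≡ fill P i j))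

Avoids : FilledBoard → FilledBoard → Set
Avoids B P = ¬ Contains B P

ExactlyOne : {n : ℕ} → (Fin n → Set) → Set
ExactlyOne {n} P = Σ (Fin n) λ x → P x × ((y : Fin n) → P y → y ≡ x)

IsPermFilling : {n : ℕ} → Shape n → (Fin n → Fin n → Bool) → Set
IsPermFilling {n} S F =
  ((c r : Fin n) → F c r ≡ true → S c r ≡ true) ×
  ((r : Fin n) → ExactlyOne (λ c → F c r ≡ true)) ×
  ((c : Fin n) → ExactlyOne (λ r → F c r ≡ true))

shape1324 : Shape 2
shape1324 _ _ = true

fill1324 : Fin 2 → Fin 2 → Bool
fill1324 zero (suc zero) = true
fill1324 (suc zero) zero = true
fill1324 _ _ = false

B1324 : FilledBoard
B1324 = board 2 shape1324 fill1324

shape3416725 : Shape 3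
shape3416725 zero zero = false
shape3416725 (suc (suc zero)) (suc (suc zero)) = false
shape3416725 _ _ = true

fill3416725 : Fin 3 → Fin 3 → Bool
fill3416725 zero (suc zero) = true
fill3416725 (suc zero) (suc (suc zero)) = true
fill3416725 (suc (suc zero)) zero = true
fill3416725 _ _ = false

B3416725 : FilledBoard
B3416725 = board 3 shape3416725 fill3416725

Good : {n : ℕ} → Shape n → (Fin n → Fin n → Bool) → Set
Good {n} S F =
  IsPermFilling S F ×
  Avoids (board n S F) B1324 × Avoids (board n S F) B3416725

-- A permutation filling of a board S is recorded as a *placement*: a permutation σ
-- sending each column c to the row of its 1, with every cell (c, σ c) in S.
--
-- Deleting the last column and its row gives a smaller skew-Ferrers board, and
-- occurrences move faithfully between a placement and its deletion.  The proof is by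
-- induction on the size n, the last column carrying all the work:
--   * Uniqueness.  An avoiding placement maximises the row of the 1 in the last column
--     over all placements of a skew-Ferrers board (a counting argument produces a
--     column crossing the two placements; convexity then forces a pattern).  Hence two
--     avoiding placements agree on the last column, and by induction on the rest.
--   * Existence.  Starting from any placement ρ, extend an avoiding placement of the
--     board without the last column and row ρ(last) by the cell (last, ρ(last)).  Any
--     occurrence in the result uses the last column, and then a swap of two columns or a
--     3-cycle gives a placement with a strictly higher 1 in the last column.  This can
--     only happen finitely often, so eventually the extension is avoiding.
-- The antidiagonal provides the initial placement.

module Submission where

open import Defs
open import Data.Nat using (ℕ)
open import Data.Fin using (Fin)
open import Data.Bool using (Bool)
open import Data.Product using (Σ; _×_)
open import Relation.Binary.PropositionalEquality using (_≡_)

import Data.Nat as ℕ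
open import Data.Nat using (zero; suc; z<s; s<s; s≤s⁻¹)
open import Data.Nat.Properties
  using (<⇒≤; ≤-trans; <-trans; <⇒≱; ≰⇒>; ≮⇒≥; n≮n)
open import Data.Fin using (zero; suc; _≤_; _<_; _>_; _≤?_; _<?_; toℕ; fromℕ; fromℕ<; inject≤; punchIn; punchOut)
open import Data.Fin.Properties
  using (_≟_; ≤-refl; ≤-antisym; <-cmp; <⇒≢; ≤fromℕ; toℕ<n; toℕ-injective; toℕ-inject≤;
         inject≤-injective; fromℕ<-injective; any?; injective⇒≤; ≤∧≢⇒<;
         punchIn-mono-≤; punchIn-cancel-≤; punchIn-punchOut)
open import Data.Fin.Induction using (>-wellFounded)
open import Data.Fin.Permutation
  using (Permutation′; permutation; _⟨$⟩ʳ_; _⟨$⟩ˡ_; inverseˡ; inverseʳ; _∘ₚ_; reverse;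
         transpose; remove; insert; insert-punchIn; punchIn-permute)
open import Data.Bool using (true; false)
open import Data.Bool.Properties using (¬-not) renaming (_≟_ to _≟ᵇ_)
open import Data.Product using (_,_; proj₁; proj₂; ∃; ∃₂)
open import Data.Sum using (_⊎_; inj₁; inj₂)
open import Data.Empty using (⊥)
open import Function using (_∘_)
open import Induction.WellFounded using (Acc; acc)
open import Relation.Nullary using (¬_; Dec; yes; no; does; contradiction)
open import Relation.Nullary.Decidable using (dec-true; dec-false; _×-dec_)
open import Relation.Binary.PropositionalEquality
  using (_≢_; refl; sym; trans; cong; subst; subst₂; module ≡-Reasoning)
open import Relation.Binary using (tri<; tri≈; tri>)

private
  variable
    n : ℕ
    S : Shape n

punchIn-mono-< : (i : Fin (suc n)) {j k : Fin n} → j < k → punchIn i j < punchIn i k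
punchIn-mono-< i {j} {k} j<k = ≰⇒> (λ k≤j → <⇒≱ j<k (punchIn-cancel-≤ i k j k≤j))

punchIn-cancel-< : (i : Fin (suc n)) {j k : Fin n} → punchIn i j < punchIn i k → j < k
punchIn-cancel-< i {j} {k} lt = ≰⇒> (λ k≤j → <⇒≱ lt (punchIn-mono-≤ i k j k≤j))

punchIn-onto : {i c : Fin (suc n)} → i ≢ c → ∃ λ a → punchIn i a ≡ c
punchIn-onto i≢c = punchOut i≢c , punchIn-punchOut i≢c

<⇒last≢ : {a b : Fin (suc n)} → a < b → fromℕ n ≢ a
<⇒last≢ {b = b} a<b refl = <⇒≱ a<b (≤fromℕ b)

>⇒≢ : {a b : Fin n} → a < b → b ≢ a
>⇒≢ a<b = <⇒≢ a<b ∘ sym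

permute-injective : (π : Permutation′ n) {a b : Fin n} → π ⟨$⟩ʳ a ≡ π ⟨$⟩ʳ b → a ≡ b
permute-injective π {a} {b} e = trans (sym (inverseˡ π)) (trans (cong (π ⟨$⟩ˡ_) e) (inverseˡ π))

transpose-i : (i j : Fin n) → transpose i j ⟨$⟩ʳ i ≡ j
transpose-i i j rewrite dec-true (i ≟ i) refl = refl

transpose-j : (i j : Fin n) → transpose i j ⟨$⟩ʳ j ≡ i
transpose-j i j with j ≟ i
... | yes j≡i = j≡i
... | no _ rewrite dec-true (j ≟ j) refl = refl

transpose-fixes : {i j k : Fin n} → k ≢ i → k ≢ j → transpose i j ⟨$⟩ʳ k ≡ k
transpose-fixes {i = i} {j} {k} k≢i k≢j rewrite dec-false (k ≟ i) k≢i | dec-false (k ≟ j) k≢j = refl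

shift-row : (S : Shape n) {c r r′ : Fin n} {v : Bool} → r ≡ r′ → S c r ≡ v → S c r′ ≡ v
shift-row S {c} {v = v} = subst (λ r → S c r ≡ v)

rectangle : IsSkewFerrers S → {a b c d k l : Fin n} → S a b ≡ true → S c d ≡ true →
            a ≤ k → k ≤ c → b ≤ l → l ≤ d → S k l ≡ true
rectangle sf {a} {b} {c} {d} {k} {l} sab scd a≤k k≤c b≤l l≤d =
  sf a b c d sab scd (≤-trans a≤k k≤c) (≤-trans b≤l l≤d) k l a≤k k≤c b≤l l≤d

column-convex : IsSkewFerrers S → {k b d l : Fin n} → S k b ≡ true → S k d ≡ true →
                b ≤ l → l ≤ d → S k l ≡ true
column-convex sf skb skd = rectangle sf skb skd ≤-refl ≤-refl

record Placement (S : Shape n) : Set where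
  field
    perm : Permutation′ n
    fits : (c : Fin n) → S c (perm ⟨$⟩ʳ c) ≡ true
open Placement

row : {S : Shape n} → Placement S → Fin n → Fin n
row σ c = perm σ ⟨$⟩ʳ c

row-injective : (σ : Placement S) {a b : Fin n} → row σ a ≡ row σ b → a ≡ b
row-injective σ = permute-injective (perm σ)

filling : {S : Shape n} → Placement S → Fin n → Fin n → Bool
filling σ c r = does (row σ c ≟ r)

filling-at : (σ : Placement S) {c r : Fin n} → row σ c ≡ r → filling σ c r ≡ true
filling-at σ {c} {r} = dec-true (row σ c ≟ r)

filling-off : (σ : Placement S) {c r : Fin n} → row σ c ≢ r → filling σ c r ≡ false
filling-off σ {c} {r} = dec-false (row σ c ≟ r)

filling⇒row : (σ : Placement S) {c r : Fin n} → filling σ c r ≡ true → row σ c ≡ r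
filling⇒row σ {c} {r} e with row σ c ≟ r
... | yes p = p
filling⇒row σ () | no _

filling-isPerm : (σ : Placement S) → IsPermFilling S (filling σ)
filling-isPerm {S = S} σ = in-shape , one-per-row , one-per-column
  where
  in-shape : ∀ c r → filling σ c r ≡ true → S c r ≡ true
  in-shape c r e = subst (λ r → S c r ≡ true) (filling⇒row σ e) (fits σ c)
  one-per-row : ∀ r → ExactlyOne (λ c → filling σ c r ≡ true)
  one-per-row r = perm σ ⟨$⟩ˡ r , filling-at σ (inverseʳ (perm σ)) ,
    λ c e → row-injective σ (trans (filling⇒row σ e) (sym (inverseʳ (perm σ))))
  one-per-column : ∀ c → ExactlyOne (λ r → filling σ c r ≡ true)
  one-per-column c = row σ c , filling-at σ refl , λ r e → sym (filling⇒row σ e)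

does-unique : {P : Set} (b : Bool) (p? : Dec P) → (b ≡ true → P) → (P → b ≡ true) → b ≡ does p?
does-unique true  p? b⇒p p⇒b = sym (dec-true p? (b⇒p refl))
does-unique false p? b⇒p p⇒b = sym (dec-false p? (λ p → contradiction (p⇒b p) λ ()))

placementOf : {F : Fin n → Fin n → Bool} → IsPermFilling S F →
              Σ (Placement S) λ σ → (c r : Fin n) → F c r ≡ filling σ c r
placementOf {n = n} {S = S} {F} (in-shape , rows , columns) = σ , agrees
  where
  rowOf : Fin n → Fin n
  rowOf c = proj₁ (columns c)
  columnOf : Fin n → Fin n
  columnOf r = proj₁ (rows r)
  rowOf-one : ∀ c → F c (rowOf c) ≡ true
  rowOf-one c = proj₁ (proj₂ (columns c))
  columnOf-one : ∀ r → F (columnOf r) r ≡ true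
  columnOf-one r = proj₁ (proj₂ (rows r))
  σ : Placement S
  σ = record
    { perm = permutation rowOf columnOf
        (λ r → sym (proj₂ (proj₂ (columns (columnOf r))) r (columnOf-one r)))
        (λ c → sym (proj₂ (proj₂ (rows (rowOf c))) c (rowOf-one c)))
    ; fits = λ c → in-shape c (rowOf c) (rowOf-one c) }
  agrees : ∀ c r → F c r ≡ filling σ c r
  agrees c r = does-unique (F c r) (rowOf c ≟ r)
    (λ e → sym (proj₂ (proj₂ (columns c)) r e))
    (λ e → subst (λ r → F c r ≡ true) e (rowOf-one c))

contains-resp-fill : {F G : Fin n → Fin n → Bool} (P : FilledBoard) → (∀ c r → F c r ≡ G c r) →
                     Contains (board n S F) P → Contains (board n S G) P
contains-resp-fill P F≗G (φ , ψ , φ↑ , ψ↑ , cell) =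
  φ , ψ , φ↑ , ψ↑ , λ i j → proj₁ (cell i j) , λ s → trans (sym (F≗G (φ i) (ψ j))) (proj₂ (cell i j) s)

record Occ1324 {S : Shape n} (σ : Placement S) : Set where
  constructor occ1324
  field
    c₁ c₂     : Fin n
    c₁<c₂     : c₁ < c₂
    descent   : row σ c₂ < row σ c₁
    corner₁₂  : S c₁ (row σ c₂) ≡ true
    corner₂₁  : S c₂ (row σ c₁) ≡ true

record Occ3416725 {S : Shape n} (σ : Placement S) : Set where
  constructor occ3416725
  field
    c₁ c₂ c₃  : Fin n
    c₁<c₂     : c₁ < c₂
    c₂<c₃     : c₂ < c₃
    r₃<r₁     : row σ c₃ < row σ c₁
    r₁<r₂     : row σ c₁ < row σ c₂
    missing₁₃ : S c₁ (row σ c₃) ≡ false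
    missing₃₂ : S c₃ (row σ c₂) ≡ false
    corner₁₂  : S c₁ (row σ c₂) ≡ true
    corner₂₃  : S c₂ (row σ c₃) ≡ true
    corner₂₁  : S c₂ (row σ c₁) ≡ true
    corner₃₁  : S c₃ (row σ c₁) ≡ true

Avoiding : {S : Shape n} → Placement S → Set
Avoiding σ = ¬ Occ1324 σ × ¬ Occ3416725 σ

boardOf : {S : Shape n} → Placement S → FilledBoard
boardOf {n} {S} σ = board n S (filling σ)

pair : Fin n → Fin n → Fin 2 → Fin n
pair a b zero       = a
pair a b (suc zero) = b

pair-increasing : {a b : Fin n} → a < b → StrictlyIncreasing (pair a b)
pair-increasing a<b zero       (suc zero) _ = a<b
pair-increasing a<b (suc zero) (suc zero) (s<s ())

triple : Fin n → Fin n → Fin n → Fin 3 → Fin n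
triple a b c zero             = a
triple a b c (suc zero)       = b
triple a b c (suc (suc zero)) = c

triple-increasing : {a b c : Fin n} → a < b → b < c → StrictlyIncreasing (triple a b c)
triple-increasing a<b b<c zero             (suc zero)       _ = a<b
triple-increasing a<b b<c zero             (suc (suc zero)) _ = <-trans a<b b<c
triple-increasing a<b b<c (suc zero)       (suc (suc zero)) _ = b<c
triple-increasing a<b b<c (suc zero)       (suc zero)       (s<s ())
triple-increasing a<b b<c (suc (suc zero)) (suc zero)       (s<s ())
triple-increasing a<b b<c (suc (suc zero)) (suc (suc zero)) (s<s (s<s ()))

occ1324⇒contains : (σ : Placement S) → Occ1324 σ → Contains (boardOf σ) B1324
occ1324⇒contains {S = S} σ (occ1324 c₁ c₂ c₁<c₂ descent k₁₂ k₂₁) =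
  φ , ψ , pair-increasing c₁<c₂ , pair-increasing descent , cell
  where
  φ ψ : Fin 2 → Fin _
  φ = pair c₁ c₂
  ψ = pair (row σ c₂) (row σ c₁)
  cell : (i j : Fin 2) → (S (φ i) (ψ j) ≡ shape1324 i j) ×
                         (shape1324 i j ≡ true → filling σ (φ i) (ψ j) ≡ fill1324 i j)
  cell zero       zero       = k₁₂ , λ _ → filling-off σ (>⇒≢ descent)
  cell zero       (suc zero) = fits σ c₁ , λ _ → filling-at σ refl
  cell (suc zero) zero       = fits σ c₂ , λ _ → filling-at σ refl
  cell (suc zero) (suc zero) = k₂₁ , λ _ → filling-off σ (<⇒≢ descent)

contains⇒occ1324 : (σ : Placement S) → Contains (boardOf σ) B1324 → Occ1324 σ
contains⇒occ1324 {S = S} σ (φ , ψ , φ↑ , ψ↑ , cell) =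
  occ1324 (φ zero) (φ (suc zero)) (φ↑ zero (suc zero) z<s)
    (subst₂ _<_ (sym row₁) (sym row₀) (ψ↑ zero (suc zero) z<s))
    (shift-row S (sym row₁) (proj₁ (cell zero zero)))
    (shift-row S (sym row₀) (proj₁ (cell (suc zero) (suc zero))))
  where
  row₀ : row σ (φ zero) ≡ ψ (suc zero)
  row₀ = filling⇒row σ (proj₂ (cell zero (suc zero)) refl)
  row₁ : row σ (φ (suc zero)) ≡ ψ zero
  row₁ = filling⇒row σ (proj₂ (cell (suc zero) zero) refl)

occ3416725⇒contains : (σ : Placement S) → Occ3416725 σ → Contains (boardOf σ) B3416725
occ3416725⇒contains {S = S} σ (occ3416725 c₁ c₂ c₃ c₁<c₂ c₂<c₃ r₃<r₁ r₁<r₂ m₁₃ m₃₂ k₁₂ k₂₃ k₂₁ k₃₁) =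
  φ , ψ , triple-increasing c₁<c₂ c₂<c₃ , triple-increasing r₃<r₁ r₁<r₂ , cell
  where
  φ ψ : Fin 3 → Fin _
  φ = triple c₁ c₂ c₃
  ψ = triple (row σ c₃) (row σ c₁) (row σ c₂)
  cell : (i j : Fin 3) → (S (φ i) (ψ j) ≡ shape3416725 i j) ×
                         (shape3416725 i j ≡ true → filling σ (φ i) (ψ j) ≡ fill3416725 i j)
  cell zero             zero             = m₁₃ , λ ()
  cell zero             (suc zero)       = fits σ c₁ , λ _ → filling-at σ refl
  cell zero             (suc (suc zero)) = k₁₂ , λ _ → filling-off σ (<⇒≢ r₁<r₂)
  cell (suc zero)       zero             = k₂₃ , λ _ → filling-off σ (>⇒≢ (<-trans r₃<r₁ r₁<r₂))
  cell (suc zero)       (suc zero)       = k₂₁ , λ _ → filling-off σ (>⇒≢ r₁<r₂)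
  cell (suc zero)       (suc (suc zero)) = fits σ c₂ , λ _ → filling-at σ refl
  cell (suc (suc zero)) zero             = fits σ c₃ , λ _ → filling-at σ refl
  cell (suc (suc zero)) (suc zero)       = k₃₁ , λ _ → filling-off σ (<⇒≢ r₃<r₁)
  cell (suc (suc zero)) (suc (suc zero)) = m₃₂ , λ ()

contains⇒occ3416725 : (σ : Placement S) → Contains (boardOf σ) B3416725 → Occ3416725 σ
contains⇒occ3416725 {S = S} σ (φ , ψ , φ↑ , ψ↑ , cell) =
  occ3416725 (φ 0₃) (φ 1₃) (φ 2₃) (φ↑ 0₃ 1₃ z<s) (φ↑ 1₃ 2₃ (s<s z<s))
    (subst₂ _<_ (sym row₂) (sym row₀) (ψ↑ 0₃ 1₃ z<s))
    (subst₂ _<_ (sym row₀) (sym row₁) (ψ↑ 1₃ 2₃ (s<s z<s)))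
    (shift-row S (sym row₂) (proj₁ (cell 0₃ 0₃)))
    (shift-row S (sym row₁) (proj₁ (cell 2₃ 2₃)))
    (shift-row S (sym row₁) (proj₁ (cell 0₃ 2₃)))
    (shift-row S (sym row₂) (proj₁ (cell 1₃ 0₃)))
    (shift-row S (sym row₀) (proj₁ (cell 1₃ 1₃)))
    (shift-row S (sym row₀) (proj₁ (cell 2₃ 1₃)))
  where
  0₃ 1₃ 2₃ : Fin 3
  0₃ = zero
  1₃ = suc zero
  2₃ = suc (suc zero)
  row₀ : row σ (φ 0₃) ≡ ψ 1₃
  row₀ = filling⇒row σ (proj₂ (cell 0₃ 1₃) refl)
  row₁ : row σ (φ 1₃) ≡ ψ 2₃
  row₁ = filling⇒row σ (proj₂ (cell 1₃ 2₃) refl)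
  row₂ : row σ (φ 2₃) ≡ ψ 0₃
  row₂ = filling⇒row σ (proj₂ (cell 2₃ 0₃) refl)

good : (σ : Placement S) → Avoiding σ → Good S (filling σ)
good σ (no1324 , no3416725) =
  filling-isPerm σ , no1324 ∘ contains⇒occ1324 σ , no3416725 ∘ contains⇒occ3416725 σ

avoiding : {F : Fin n → Fin n → Bool} → Good S F → (τ : Placement S) →
           (∀ c r → F c r ≡ filling τ c r) → Avoiding τ
avoiding {S = S} (_ , no1324 , no3416725) τ F≗τ =
  (λ o → no1324 (contains-resp-fill {S = S} B1324 (λ c r → sym (F≗τ c r)) (occ1324⇒contains τ o))) ,
  (λ o → no3416725 (contains-resp-fill {S = S} B3416725 (λ c r → sym (F≗τ c r)) (occ3416725⇒contains τ o)))

delete : Shape (suc n) → Fin (suc n) → Fin (suc n) → Shape n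
delete S i h a b = S (punchIn i a) (punchIn h b)

delete-skewFerrers : {S : Shape (suc n)} (i h : Fin (suc n)) → IsSkewFerrers S → IsSkewFerrers (delete S i h)
delete-skewFerrers i h sf a b c d sab scd a≤c b≤d k l a≤k k≤c b≤l l≤d =
  sf (punchIn i a) (punchIn h b) (punchIn i c) (punchIn h d) sab scd
     (punchIn-mono-≤ i a c a≤c) (punchIn-mono-≤ h b d b≤d) (punchIn i k) (punchIn h l)
     (punchIn-mono-≤ i a k a≤k) (punchIn-mono-≤ i k c k≤c)
     (punchIn-mono-≤ h b l b≤l) (punchIn-mono-≤ h l d l≤d)

Deletion : {S : Shape (suc n)} → Placement S → (i h : Fin (suc n)) → Placement (delete S i h) → Set
Deletion {n} σ i h τ = (a : Fin n) → row σ (punchIn i a) ≡ punchIn h (row τ a)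

restrict : {S : Shape (suc n)} (σ : Placement S) (i : Fin (suc n)) {h : Fin (suc n)} →
           row σ i ≡ h → Placement (delete S i h)
restrict {S = S} σ i refl = record
  { perm = remove i (perm σ)
  ; fits = λ a → shift-row S (punchIn-permute (perm σ) i a) (fits σ (punchIn i a)) }

restrict-deletion : {S : Shape (suc n)} (σ : Placement S) (i : Fin (suc n)) {h : Fin (suc n)}
                    (e : row σ i ≡ h) → Deletion σ i h (restrict σ i e)
restrict-deletion σ i refl = punchIn-permute (perm σ) i

extend : (S : Shape (suc n)) (i h : Fin (suc n)) → S i h ≡ true → Placement (delete S i h) → Placement S
extend S i h sih τ = record { perm = insert i h (perm τ) ; fits = fits′ }
  where
  fits′ : ∀ c → S c (insert i h (perm τ) ⟨$⟩ʳ c) ≡ true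
  fits′ c with i ≟ c
  ... | yes refl = sih
  ... | no i≢c   = subst (λ c → S c (punchIn h (row τ (punchOut i≢c))) ≡ true)
                         (punchIn-punchOut i≢c) (fits τ (punchOut i≢c))

extend-at : (S : Shape (suc n)) (i h : Fin (suc n)) (sih : S i h ≡ true) (τ : Placement (delete S i h)) →
            row (extend S i h sih τ) i ≡ h
extend-at S i h sih τ with i ≟ i
... | yes _   = refl
... | no i≢i = contradiction refl i≢i

extend-deletion : (S : Shape (suc n)) (i h : Fin (suc n)) (sih : S i h ≡ true) (τ : Placement (delete S i h)) →
                  Deletion (extend S i h sih τ) i h τ
extend-deletion S i h sih τ = insert-punchIn i h (perm τ)

module Transfer {S : Shape (suc n)} {σ : Placement S} {i h : Fin (suc n)}
                {τ : Placement (delete S i h)} (D : Deletion σ i h τ) where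

  cell : (a b : Fin n) → S (punchIn i a) (row σ (punchIn i b)) ≡ delete S i h a (row τ b)
  cell a b = cong (S (punchIn i a)) (D b)

  lift-order : {a b : Fin n} → row τ a < row τ b → row σ (punchIn i a) < row σ (punchIn i b)
  lift-order {a} {b} lt = subst₂ _<_ (sym (D a)) (sym (D b)) (punchIn-mono-< h lt)

  lower-order : {a b : Fin n} → row σ (punchIn i a) < row σ (punchIn i b) → row τ a < row τ b
  lower-order {a} {b} lt = punchIn-cancel-< h (subst₂ _<_ (D a) (D b) lt)

  lift1324 : Occ1324 τ → Occ1324 σ
  lift1324 (occ1324 a₁ a₂ a₁<a₂ descent k₁₂ k₂₁) =
    occ1324 (punchIn i a₁) (punchIn i a₂) (punchIn-mono-< i a₁<a₂) (lift-order descent)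
      (trans (cell a₁ a₂) k₁₂) (trans (cell a₂ a₁) k₂₁)

  lift3416725 : Occ3416725 τ → Occ3416725 σ
  lift3416725 (occ3416725 a₁ a₂ a₃ a₁<a₂ a₂<a₃ r₃<r₁ r₁<r₂ m₁₃ m₃₂ k₁₂ k₂₃ k₂₁ k₃₁) =
    occ3416725 (punchIn i a₁) (punchIn i a₂) (punchIn i a₃)
      (punchIn-mono-< i a₁<a₂) (punchIn-mono-< i a₂<a₃) (lift-order r₃<r₁) (lift-order r₁<r₂)
      (trans (cell a₁ a₃) m₁₃) (trans (cell a₃ a₂) m₃₂) (trans (cell a₁ a₂) k₁₂)
      (trans (cell a₂ a₃) k₂₃) (trans (cell a₂ a₁) k₂₁) (trans (cell a₃ a₁) k₃₁)

  restriction-avoiding : Avoiding σ → Avoiding τ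
  restriction-avoiding (no1324 , no3416725) = no1324 ∘ lift1324 , no3416725 ∘ lift3416725

  lower1324 : (o : Occ1324 σ) → i ≢ Occ1324.c₁ o → i ≢ Occ1324.c₂ o → Occ1324 τ
  lower1324 (occ1324 c₁ c₂ c₁<c₂ descent k₁₂ k₂₁) i≢c₁ i≢c₂
    with punchIn-onto i≢c₁ | punchIn-onto i≢c₂
  ... | a₁ , refl | a₂ , refl =
    occ1324 a₁ a₂ (punchIn-cancel-< i c₁<c₂) (lower-order descent)
      (trans (sym (cell a₁ a₂)) k₁₂) (trans (sym (cell a₂ a₁)) k₂₁)

  lower3416725 : (o : Occ3416725 σ) → i ≢ Occ3416725.c₁ o → i ≢ Occ3416725.c₂ o →
                 i ≢ Occ3416725.c₃ o → Occ3416725 τ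
  lower3416725 (occ3416725 c₁ c₂ c₃ c₁<c₂ c₂<c₃ r₃<r₁ r₁<r₂ m₁₃ m₃₂ k₁₂ k₂₃ k₂₁ k₃₁) i≢c₁ i≢c₂ i≢c₃
    with punchIn-onto i≢c₁ | punchIn-onto i≢c₂ | punchIn-onto i≢c₃
  ... | a₁ , refl | a₂ , refl | a₃ , refl =
    occ3416725 a₁ a₂ a₃ (punchIn-cancel-< i c₁<c₂) (punchIn-cancel-< i c₂<c₃)
      (lower-order r₃<r₁) (lower-order r₁<r₂)
      (trans (sym (cell a₁ a₃)) m₁₃) (trans (sym (cell a₃ a₂)) m₃₂) (trans (sym (cell a₁ a₂)) k₁₂)
      (trans (sym (cell a₂ a₃)) k₂₃) (trans (sym (cell a₂ a₁)) k₂₁) (trans (sym (cell a₃ a₁)) k₃₁)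

-- If σ x₀ < τ x₀, then some column x crosses the other way: τ x ≤ σ x₀ < σ x.
-- Otherwise σ would map the σ x₀ + 1 columns with τ-row ≤ σ x₀ injectively into the
-- σ x₀ rows strictly below σ x₀.
crossing : (σ τ : Permutation′ n) (x₀ : Fin n) → σ ⟨$⟩ʳ x₀ < τ ⟨$⟩ʳ x₀ →
           ∃ λ x → τ ⟨$⟩ʳ x ≤ σ ⟨$⟩ʳ x₀ × σ ⟨$⟩ʳ x₀ < σ ⟨$⟩ʳ x
crossing {n} σ τ x₀ g<h = decide (any? λ x → (τ ⟨$⟩ʳ x ≤? g) ×-dec (g <? σ ⟨$⟩ʳ x))
  where
  g : Fin n
  g = σ ⟨$⟩ʳ x₀
  Crosses : Fin n → Set
  Crosses x = τ ⟨$⟩ʳ x ≤ g × g < σ ⟨$⟩ʳ x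

  module NoCrossing (none : ¬ ∃ Crosses) where
    -- the g + 1 columns whose τ-row is at most g, all sent by σ strictly below g
    source : Fin (suc (toℕ g)) → Fin n
    source k = τ ⟨$⟩ˡ inject≤ k (toℕ<n g)

    τ-source≤ : ∀ k → τ ⟨$⟩ʳ source k ≤ g
    τ-source≤ k = subst (λ r → toℕ r ℕ.≤ toℕ g) (sym (inverseʳ τ))
                    (subst (ℕ._≤ toℕ g) (sym (toℕ-inject≤ k _)) (s≤s⁻¹ (toℕ<n k)))

    σ-source< : ∀ k → toℕ (σ ⟨$⟩ʳ source k) ℕ.< toℕ g
    σ-source< k = ≤∧≢⇒< (≮⇒≥ λ g<σ → none (source k , τ-source≤ k , g<σ)) σ-source≢g
      where
      σ-source≢g : σ ⟨$⟩ʳ source k ≢ g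
      σ-source≢g e = <⇒≱ g<h (subst (λ x → τ ⟨$⟩ʳ x ≤ g) (permute-injective σ e) (τ-source≤ k))

    squeeze : Fin (suc (toℕ g)) → Fin (toℕ g)
    squeeze k = fromℕ< (σ-source< k)

    squeeze-injective : ∀ {k l} → squeeze k ≡ squeeze l → k ≡ l
    squeeze-injective {k} {l} e = inject≤-injective _ _ k l (begin
      inject≤ k _                 ≡⟨ sym (inverseʳ τ) ⟩
      τ ⟨$⟩ʳ source k             ≡⟨ cong (τ ⟨$⟩ʳ_) (permute-injective σ
                                        (toℕ-injective (fromℕ<-injective _ _ (σ-source< k) (σ-source< l) e))) ⟩
      τ ⟨$⟩ʳ source l             ≡⟨ inverseʳ τ ⟩
      inject≤ l _                 ∎)
      where open ≡-Reasoning

  decide : Dec (∃ Crosses) → ∃ Crosses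
  decide (yes found) = found
  decide (no none)   = contradiction (injective⇒≤ (NoCrossing.squeeze-injective none)) (n≮n (toℕ g))

-- Suppose σ(last) = g < h = τ(last) and let c
-- be the column with σ c = h.  The cell (c, g) must lie outside S (else c, last form a
-- 1324); a column x crossing σ and τ (τ x ≤ g < σ x) then lies strictly between c and
-- last, and by convexity either x, last form a 1324 or c, x, last form a 3416725.
module Maximality {S : Shape (suc n)} (sf : IsSkewFerrers S) {σ : Placement S}
                  (σ-avoids : Avoiding σ) (τ : Placement S) where

  last : Fin (suc n)
  last = fromℕ n

  module Below (g<h : row σ last < row τ last) where
    g h c : Fin (suc n)
    g = row σ last
    h = row τ last
    c = perm σ ⟨$⟩ˡ h

    σc≡h : row σ c ≡ h
    σc≡h = inverseʳ (perm σ)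

    c<last : c < last
    c<last = ≤∧≢⇒< (≤fromℕ c) (λ c≡last → <⇒≢ g<h (trans (cong (row σ) (sym c≡last)) σc≡h))

    ch-inside : S c h ≡ true
    ch-inside = shift-row S σc≡h (fits σ c)

    lastσc-inside : S last (row σ c) ≡ true
    lastσc-inside = shift-row S (sym σc≡h) (fits τ last)

    g<σc : g < row σ c
    g<σc = subst (g <_) (sym σc≡h) g<h

    cg-outside : S c g ≢ true
    cg-outside cg-inside = proj₁ σ-avoids (occ1324 c last c<last g<σc cg-inside lastσc-inside)

    module Crossed (x : Fin (suc n)) (τx≤g : row τ x ≤ g) (g<σx : g < row σ x) where
      xg-inside : S x g ≡ true
      xg-inside = column-convex sf (fits τ x) (fits σ x) τx≤g (<⇒≤ g<σx)

      -- otherwise (c, g) would lie in the rectangle spanned by (x, τ x) and (c, h)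
      c<x : c < x
      c<x with <-cmp x c
      ... | tri< x<c _ _ = contradiction (rectangle sf (fits τ x) ch-inside (<⇒≤ x<c) ≤-refl τx≤g (<⇒≤ g<h))
                                         cg-outside
      ... | tri≈ _ x≡c _ = contradiction (subst (λ y → S y g ≡ true) x≡c xg-inside) cg-outside
      ... | tri> _ _ c<x = c<x

      x<last : x < last
      x<last = ≤∧≢⇒< (≤fromℕ x) (λ x≡last → <⇒≱ g<h (subst (λ y → row τ y ≤ g) x≡last τx≤g))

      lastσx-outside : S last (row σ x) ≢ true
      lastσx-outside = proj₁ σ-avoids ∘ occ1324 x last x<last g<σx xg-inside

      -- the last column is an interval containing g and h, and σ x ≠ h = σ c
      h<σx : h < row σ x
      h<σx with <-cmp (row σ x) h
      ... | tri< σx<h _ _ = contradiction (column-convex sf (fits σ last) (fits τ last) (<⇒≤ g<σx) (<⇒≤ σx<h))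
                                          lastσx-outside
      ... | tri≈ _ σx≡h _ = contradiction (row-injective σ (trans σx≡h (sym σc≡h))) (>⇒≢ c<x)
      ... | tri> _ _ h<σx = h<σx

      pattern3416725 : Occ3416725 σ
      pattern3416725 = occ3416725 c x last c<x x<last g<σc (subst (_< row σ x) (sym σc≡h) h<σx)
        (¬-not cg-outside) (¬-not lastσx-outside)
        (rectangle sf ch-inside (fits σ x) ≤-refl (<⇒≤ c<x) (<⇒≤ h<σx) ≤-refl)
        xg-inside
        (shift-row S (sym σc≡h) (column-convex sf xg-inside (fits σ x) (<⇒≤ g<h) (<⇒≤ h<σx)))
        lastσc-inside

    impossible : ⊥
    impossible with crossing (perm σ) (perm τ) last g<h
    ... | x , τx≤g , g<σx = proj₂ σ-avoids (Crossed.pattern3416725 x τx≤g g<σx)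

  maximises : row τ last ≤ row σ last
  maximises = ≮⇒≥ Below.impossible

-- Two avoiding placements of a skew-Ferrers board agree: by maximality they agree on
-- the last column, and their deletions of that column and row are avoiding placements
-- of the same smaller skew-Ferrers board.
uniqueness : IsSkewFerrers S → (σ τ : Placement S) → Avoiding σ → Avoiding τ →
             (c : Fin n) → row σ c ≡ row τ c
uniqueness {zero}  sf σ τ σ-avoids τ-avoids ()
uniqueness {suc n} {S} sf σ τ σ-avoids τ-avoids = agree
  where
  open ≡-Reasoning
  last h : Fin (suc n)
  last = fromℕ n
  h = row σ last

  last-agrees : h ≡ row τ last
  last-agrees = ≤-antisym (Maximality.maximises sf τ-avoids σ) (Maximality.maximises sf σ-avoids τ)

  σ′ τ′ : Placement (delete S last h)
  σ′ = restrict σ last refl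
  τ′ = restrict τ last (sym last-agrees)

  σ-deletion : Deletion σ last h σ′
  σ-deletion = restrict-deletion σ last refl
  τ-deletion : Deletion τ last h τ′
  τ-deletion = restrict-deletion τ last (sym last-agrees)

  rest-agrees : ∀ a → row σ′ a ≡ row τ′ a
  rest-agrees = uniqueness (delete-skewFerrers last h sf) σ′ τ′
    (Transfer.restriction-avoiding σ-deletion σ-avoids)
    (Transfer.restriction-avoiding τ-deletion τ-avoids)

  agree : ∀ c → row σ c ≡ row τ c
  agree c with last ≟ c
  ... | yes refl = last-agrees
  ... | no last≢c with punchIn-onto last≢c
  ...   | a , refl = begin
    row σ (punchIn last a)  ≡⟨ σ-deletion a ⟩
    punchIn h (row σ′ a)    ≡⟨ cong (punchIn h) (rest-agrees a) ⟩
    punchIn h (row τ′ a)    ≡⟨ sym (τ-deletion a) ⟩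
    row τ (punchIn last a)  ∎

reroute : (σ : Placement S) (p : Permutation′ n) → (∀ x → S x (row σ (p ⟨$⟩ʳ x)) ≡ true) → Placement S
reroute σ p fits′ = record { perm = p ∘ₚ perm σ ; fits = fits′ }

lands : (σ : Placement S) (p : Permutation′ n) {x y : Fin n} →
        p ⟨$⟩ʳ x ≡ y → S x (row σ y) ≡ true → S x (row σ (p ⟨$⟩ʳ x)) ≡ true
lands {S = S} σ p e = shift-row S (cong (row σ) (sym e))

Raised : {S : Shape n} → Placement S → Fin n → Set
Raised {S = S} σ l = Σ (Placement S) λ ρ → row σ l < row ρ l

-- Exchange the 1's of columns l and c, where σ c lies above σ l.
SwapMove : {S : Shape n} → Placement S → Fin n → Set
SwapMove {S = S} σ l = ∃ λ c → row σ l < row σ c × S c (row σ l) ≡ true × S l (row σ c) ≡ true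

-- Move the 1's of columns l, c₁, c₂ (σ l < σ c₁ < σ c₂) to rows σ c₁, σ c₂, σ l.
CycleMove : {S : Shape n} → Placement S → Fin n → Set
CycleMove {S = S} σ l = ∃₂ λ c₁ c₂ → row σ l < row σ c₁ × row σ c₁ < row σ c₂ ×
  S l (row σ c₁) ≡ true × S c₁ (row σ c₂) ≡ true × S c₂ (row σ l) ≡ true

swapMove? : (σ : Placement S) (l : Fin n) → Dec (SwapMove σ l)
swapMove? {S = S} σ l = any? λ c → (row σ l <? row σ c) ×-dec
  ((S c (row σ l) ≟ᵇ true) ×-dec (S l (row σ c) ≟ᵇ true))

cycleMove? : (σ : Placement S) (l : Fin n) → Dec (CycleMove σ l)
cycleMove? {S = S} σ l = any? λ c₁ → any? λ c₂ → (row σ l <? row σ c₁) ×-dec ((row σ c₁ <? row σ c₂) ×-dec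
  ((S l (row σ c₁) ≟ᵇ true) ×-dec ((S c₁ (row σ c₂) ≟ᵇ true) ×-dec (S c₂ (row σ l) ≟ᵇ true))))

swap-raises : (σ : Placement S) (l : Fin n) → SwapMove σ l → Raised σ l
swap-raises {S = S} σ l (c , l<c , k₁ , k₂) =
  reroute σ (transpose c l) fits′ , subst (row σ l <_) (cong (row σ) (sym (transpose-j c l))) l<c
  where
  fits′ : ∀ x → S x (row σ (transpose c l ⟨$⟩ʳ x)) ≡ true
  fits′ x = by-cases x (x ≟ c) (x ≟ l)
    where
    by-cases : ∀ y → Dec (y ≡ c) → Dec (y ≡ l) → S y (row σ (transpose c l ⟨$⟩ʳ y)) ≡ true
    by-cases y (yes refl) _          = lands σ (transpose c l) (transpose-i c l) k₁
    by-cases y (no _)     (yes refl) = lands σ (transpose c l) (transpose-j c l) k₂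
    by-cases y (no y≢c)   (no y≢l)   = lands σ (transpose c l) (transpose-fixes y≢c y≢l) (fits σ y)

cycle-raises : (σ : Placement S) (l : Fin n) → CycleMove σ l → Raised σ l
cycle-raises {S = S} σ l (c₁ , c₂ , l<c₁ , c₁<c₂ , k₁ , k₂ , k₃) =
  reroute σ p fits′ , subst (row σ l <_) (cong (row σ) (sym p-l)) l<c₁
  where
  p : Permutation′ _
  p = transpose c₁ c₂ ∘ₚ transpose l c₁
  l≢c₁ : l ≢ c₁
  l≢c₁ = <⇒≢ l<c₁ ∘ cong (row σ)
  l≢c₂ : l ≢ c₂
  l≢c₂ = <⇒≢ (<-trans l<c₁ c₁<c₂) ∘ cong (row σ)
  c₁≢c₂ : c₁ ≢ c₂
  c₁≢c₂ = <⇒≢ c₁<c₂ ∘ cong (row σ)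
  p-l : p ⟨$⟩ʳ l ≡ c₁
  p-l = trans (cong (transpose l c₁ ⟨$⟩ʳ_) (transpose-fixes l≢c₁ l≢c₂)) (transpose-i l c₁)
  p-c₁ : p ⟨$⟩ʳ c₁ ≡ c₂
  p-c₁ = trans (cong (transpose l c₁ ⟨$⟩ʳ_) (transpose-i c₁ c₂)) (transpose-fixes (l≢c₂ ∘ sym) (c₁≢c₂ ∘ sym))
  p-c₂ : p ⟨$⟩ʳ c₂ ≡ l
  p-c₂ = trans (cong (transpose l c₁ ⟨$⟩ʳ_) (transpose-j c₁ c₂)) (transpose-j l c₁)
  fits′ : ∀ x → S x (row σ (p ⟨$⟩ʳ x)) ≡ true
  fits′ x = by-cases x (x ≟ l) (x ≟ c₁) (x ≟ c₂)
    where
    by-cases : ∀ y → Dec (y ≡ l) → Dec (y ≡ c₁) → Dec (y ≡ c₂) → S y (row σ (p ⟨$⟩ʳ y)) ≡ true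
    by-cases y (yes refl) _          _          = lands σ p p-l k₁
    by-cases y (no _)     (yes refl) _          = lands σ p p-c₁ k₂
    by-cases y (no _)     (no _)     (yes refl) = lands σ p p-c₂ k₃
    by-cases y (no y≢l)   (no y≢c₁)  (no y≢c₂)  = lands σ p
      (trans (cong (transpose l c₁ ⟨$⟩ʳ_) (transpose-fixes y≢c₁ y≢c₂)) (transpose-fixes y≢l y≢c₁))
      (fits σ y)

occ1324⇒swap : {σ : Placement S} (o : Occ1324 σ) → SwapMove σ (Occ1324.c₂ o)
occ1324⇒swap (occ1324 c₁ c₂ _ descent k₁₂ k₂₁) = c₁ , descent , k₁₂ , k₂₁

occ3416725⇒cycle : {σ : Placement S} (o : Occ3416725 σ) → CycleMove σ (Occ3416725.c₃ o)
occ3416725⇒cycle (occ3416725 c₁ c₂ c₃ _ _ r₃<r₁ r₁<r₂ _ _ k₁₂ k₂₃ _ k₃₁) =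
  c₁ , c₂ , r₃<r₁ , r₁<r₂ , k₃₁ , k₁₂ , k₂₃

-- An occurrence in the extension not using the last column would
-- descend to τ, so every occurrence ends in the last column and provides a move.
module Extension {S : Shape (suc n)} (h : Fin (suc n)) (last-h : S (fromℕ n) h ≡ true)
                 (τ : Placement (delete S (fromℕ n) h)) (τ-avoids : Avoiding τ) where

  last : Fin (suc n)
  last = fromℕ n

  σ : Placement S
  σ = extend S last h last-h τ

  open Transfer {σ = σ} {i = last} {h = h} {τ = τ} (extend-deletion S last h last-h τ)

  avoids-or-raises : Avoiding σ ⊎ Raised σ last
  avoids-or-raises with swapMove? σ last | cycleMove? σ last
  ... | yes move | _        = inj₂ (swap-raises σ last move)
  ... | no _     | yes move = inj₂ (cycle-raises σ last move)
  ... | no no-swap | no no-cycle = inj₁ (no1324 , no3416725)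
    where
    no1324 : ¬ Occ1324 σ
    no1324 o with last ≟ Occ1324.c₂ o
    ... | yes last≡c₂ = no-swap (subst (SwapMove σ) (sym last≡c₂) (occ1324⇒swap o))
    ... | no last≢c₂  = proj₁ τ-avoids (lower1324 o (<⇒last≢ (Occ1324.c₁<c₂ o)) last≢c₂)

    no3416725 : ¬ Occ3416725 σ
    no3416725 o with last ≟ Occ3416725.c₃ o
    ... | yes last≡c₃ = no-cycle (subst (CycleMove σ) (sym last≡c₃) (occ3416725⇒cycle o))
    ... | no last≢c₃  = proj₂ τ-avoids (lower3416725 o
      (<⇒last≢ (<-trans (Occ3416725.c₁<c₂ o) (Occ3416725.c₂<c₃ o)))
      (<⇒last≢ (Occ3416725.c₂<c₃ o)) last≢c₃)

-- Starting from ρ,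
-- extend an avoiding placement of the board without the last column and row ρ(last)
-- (induction on the size); if this fails, continue from the raised placement.  The
-- row of the last 1 strictly increases, so this terminates.
existence : IsSkewFerrers S → Placement S → Σ (Placement S) Avoiding
existence {zero}  sf ρ = ρ , (λ o → case₀ (Occ1324.c₁ o)) , (λ o → case₀ (Occ3416725.c₁ o))
  where
  case₀ : Fin 0 → ⊥
  case₀ ()
existence {suc n} {S} sf ρ₀ = climb ρ₀ (>-wellFounded (row ρ₀ last))
  where
  last : Fin (suc n)
  last = fromℕ n

  climb : (ρ : Placement S) → Acc _>_ (row ρ last) → Σ (Placement S) Avoiding
  climb ρ (acc higher) = next (Extension.avoids-or-raises h (fits ρ last) τ τ-avoids)
    where
    h : Fin (suc n)
    h = row ρ last
    smaller : Σ (Placement (delete S last h)) Avoiding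
    smaller = existence (delete-skewFerrers last h sf) (restrict ρ last refl)
    τ : Placement (delete S last h)
    τ = proj₁ smaller
    τ-avoids : Avoiding τ
    τ-avoids = proj₂ smaller
    σ : Placement S
    σ = extend S last h (fits ρ last) τ

    next : Avoiding σ ⊎ Raised σ last → Σ (Placement S) Avoiding
    next (inj₁ σ-avoids)     = σ , σ-avoids
    next (inj₂ (ρ′ , raised)) =
      climb ρ′ (higher (subst (_< row ρ′ last) (extend-at S last h (fits ρ last) τ) raised))

-- The antidiagonal is a placement, so an avoiding placement exists; any good filling G
-- comes from an avoiding placement, which agrees with it by uniqueness.
lemma1p5 : (n : ℕ) (S : Shape n) → IsNice S →
    Σ (Fin n → Fin n → Bool) λ F →
      Good S F ×
      ((G : Fin n → Fin n → Bool) → Good S G → (c r : Fin n) → G c r ≡ F c r)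
lemma1p5 n S (sf , antidiagonal) = filling σ , good σ σ-avoids , unique
  where
  open ≡-Reasoning
  antidiagonal-placement : Placement S
  antidiagonal-placement = record { perm = reverse ; fits = antidiagonal }

  σ : Placement S
  σ = proj₁ (existence sf antidiagonal-placement)
  σ-avoids : Avoiding σ
  σ-avoids = proj₂ (existence sf antidiagonal-placement)

  unique : (G : Fin n → Fin n → Bool) → Good S G → (c r : Fin n) → G c r ≡ filling σ c r
  unique G G-good c r with placementOf (proj₁ G-good)
  ... | τ , G≗τ = begin
    G c r          ≡⟨ G≗τ c r ⟩
    filling τ c r  ≡⟨ cong (λ x → does (x ≟ r)) (uniqueness sf τ σ (avoiding G-good τ G≗τ) σ-avoids c) ⟩
    filling σ c r  ∎
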